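{- Consider a two-player game played on a board that is a finite set of cells in $\mathbb{Z}^2$ (each cell identified with its Cartesian coordinates $(x,y)$), under one of the three move rules (4-move, 6-move or 8-move) described in the context. Let $B$ and $R$ be the initial positions (sets of occupied cells) of the two armies, with $|B|=|R|=s$. Then no complete game (ending when one player first has her men occupying every cell of the opponent's initial set of cells) can be shorter than $h$ moves, where $$h=\max\{0,\,d(B,R)-2\}+2s-1 .$$
   Context: Move rules. A set $D$ of allowed direction vectors is fixed: under 4-move rules $D=\{(\pm1,0),(0,\pm1)\}$; under 6-move rules $D=\{(\pm1,0),(0,\pm1),\pm(1,1)\}$; under 8-move rules $D=\{(a,b): a,b\in\{ -1,0,1\},(a,b)\neq(0,0)\}$. Each player owns an army of identical men occupying distinct cells. A move consists of moving a single man of one's own army either by (i) a step: from cell $p$ to an empty cell $p+v$ with $v\in D$, or (ii) a chain of one or more jumps: each jump goes from $p$ over an occupied cell $p+v$ (occupied by a man of either army), $v\in D$, into an empty cell $p+2v$; jumped men are not removed, and the chain may be stopped at any time. Players alternate moves. The length of a game is the total number of moves made by both players. The winner is the first player whose men occupy all cells of the opponent's initial position. Distance. The norm of $(x,y)$ is $\max(|x|,|y|)$ under 8-move rules, $|x|+|y|$ under 4-move rules, and $\tfrac12(|x|+|y|+|x-y|)$ under 6-move rules. The distance between cells is $d(\mathbf a,\mathbf b)=\|\mathbf a-\mathbf b\|$, and between two sets of cells $d(B,R)=\min\{d(\mathbf b,\mathbf r):\mathbf b\in B,\mathbf r\in R\}$. -}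

module Defs where

open import Data.Nat as ℕ using (ℕ; zero; suc; _⊔_; _⊓_; _∸_; _≤_)
open import Data.Nat.DivMod using (_/_)
open import Data.Integer as ℤ using (ℤ; +_; -[1+_]; ∣_∣)
open import Data.Product using (_×_; _,_; Σ; ∃; ∃-syntax)
open import Data.Sum using (_⊎_)
open import Data.List using (List; []; _∷_; _++_; map; concatMap; length)
open import Data.List.Membership.Propositional using (_∈_; _∉_)
open import Data.List.Relation.Unary.All using (All)
open import Data.List.Relation.Unary.Unique.Propositional using (Unique)
open import Data.List.Relation.Binary.Permutation.Propositional using (_↭_)
open import Relation.Binary.PropositionalEquality using (_≡_)
open import Relation.Nullary using (¬_)

Cell : Set
Cell = ℤ × ℤ

_⊕_ : Cell → Cell → Cell
(a , b) ⊕ (c , d) = (a ℤ.+ c , b ℤ.+ d)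

_⊖_ : Cell → Cell → Cell
(a , b) ⊖ (c , d) = (a ℤ.- c , b ℤ.- d)

data Rules : Set where
  four six eight : Rules

dirs : Rules → List Cell
dirs four  = (+ 1 , + 0) ∷ (-[1+ 0 ] , + 0) ∷ (+ 0 , + 1) ∷ (+ 0 , -[1+ 0 ]) ∷ []
dirs six   = (+ 1 , + 0) ∷ (-[1+ 0 ] , + 0) ∷ (+ 0 , + 1) ∷ (+ 0 , -[1+ 0 ])
           ∷ (+ 1 , + 1) ∷ (-[1+ 0 ] , -[1+ 0 ]) ∷ []
dirs eight = (+ 1 , + 0) ∷ (-[1+ 0 ] , + 0) ∷ (+ 0 , + 1) ∷ (+ 0 , -[1+ 0 ])
           ∷ (+ 1 , + 1) ∷ (-[1+ 0 ] , -[1+ 0 ]) ∷ (+ 1 , -[1+ 0 ]) ∷ (-[1+ 0 ] , + 1) ∷ []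

norm : Rules → Cell → ℕ
norm four  (x , y) = ∣ x ∣ ℕ.+ ∣ y ∣
norm six   (x , y) = (∣ x ∣ ℕ.+ ∣ y ∣ ℕ.+ ∣ x ℤ.- y ∣) / 2
norm eight (x , y) = ∣ x ∣ ⊔ ∣ y ∣

dist : Rules → Cell → Cell → ℕ
dist r a b = norm r (a ⊖ b)

-- Minimum of a list of naturals (value 0 on the empty list; only used for nonempty lists).
minList : List ℕ → ℕ
minList [] = 0
minList (x ∷ []) = x
minList (x ∷ y ∷ ys) = x ⊓ minList (y ∷ ys)

setDist : Rules → List Cell → List Cell → ℕ
setDist r B R = minList (concatMap (λ b → map (dist r b) R) B)

-- A single jump from p to q over an occupied cell, where `others` are the
-- cells occupied by all men other than the moving one; q must be an empty board cell.
Jump : Rules → List Cell → List Cell → Cell → Cell → Set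
Jump r board others p q =
  ∃[ v ] (v ∈ dirs r × (p ⊕ v) ∈ others × q ≡ (p ⊕ v) ⊕ v × q ∈ board × q ∉ others)

data JumpChain (r : Rules) (board others : List Cell) : Cell → Cell → Set where
  one  : ∀ {p q} → Jump r board others p q → JumpChain r board others p q
  more : ∀ {p q t} → Jump r board others p q → JumpChain r board others q t →
         JumpChain r board others p t

Step : Rules → List Cell → List Cell → Cell → Cell → Set
Step r board others p q = ∃[ v ] (v ∈ dirs r × q ≡ p ⊕ v × q ∈ board × q ∉ others)

Reach : Rules → List Cell → List Cell → Cell → Cell → Set
Reach r board others p q = Step r board others p q ⊎ JumpChain r board others p q

ArmyMove : Rules → List Cell → List Cell → List Cell → List Cell → Set
ArmyMove r board opp own own' =
  ∃[ p ] ∃[ q ] ∃[ rest ] (own ↭ (p ∷ rest) × own' ↭ (q ∷ rest) × Reach r board (rest ++ opp) p q)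

data Player : Set where
  blue red : Player

other : Player → Player
other blue = red
other red  = blue

Position : Set
Position = List Cell × List Cell

Move : Rules → List Cell → Player → Position → Position → Set
Move r board blue (b , rd) (b' , rd') = ArmyMove r board rd b b' × rd' ≡ rd
Move r board red  (b , rd) (b' , rd') = ArmyMove r board b rd rd' × b' ≡ b

Won : List Cell → List Cell → Position → Set
Won B R (b , rd) = All (_∈ b) R ⊎ All (_∈ rd) B

data Game (r : Rules) (board B R : List Cell) : Player → Position → ℕ → Set where
  stop : ∀ {pl st} → Won B R st → Game r board B R pl st 0
  step : ∀ {pl st st' n} → ¬ Won B R st → Move r board pl st st' →
         Game r board B R (other pl) st' n → Game r board B R pl st (suc n)

bound : Rules → List Cell → List Cell → ℕ → ℕ
bound r B R s = (setDist r B R ∸ 2) ℕ.+ (2 ℕ.* s ∸ 1)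

-- A side consists of a player's initial cells together with his current men.
-- While the two sides are at distance at least 3, no man can jump over an enemy
-- man, and a jump over a friendly man lands at most one unit closer to the enemy
-- side than that man; so each move lowers the distance between the sides by at
-- most 1, and after the first d(B,R) − 2 moves no man stands on an enemy initial
-- cell yet.  From then on a move fills at most one target cell of its player, so
-- if the player to move still has u cells to fill and the other v, at least
-- min(2u − 1, 2v) moves remain; with u = v = s this is 2s − 1.
module Submission where

open import Defs
open import Algebra.Properties.CommutativeSemigroup using (interchange)
open import Data.Nat using (ℕ; zero; suc; _≤_; _≤?_; _+_; _*_; _∸_; _⊔_; _⊓_; z≤n; s≤s)
import Data.Nat.Properties as ℕ
open import Data.Nat.DivMod using (_/_; /-monoˡ-≤; m/n≡1+[m∸n]/n)
import Data.Nat.Tactic.RingSolver as ℕ-Solver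
open import Data.Integer.Base as ℤ using (ℤ; ∣_∣)
import Data.Integer.Properties as ℤ
open import Data.Integer.Tactic.RingSolver using (solve-∀)
open import Data.Product.Base using (_×_; _,_; proj₂; ∃-syntax)
open import Data.Product.Properties using (≡-dec)
open import Data.Sum.Base using (_⊎_; inj₁; inj₂; reduce)
open import Data.List.Base using (List; []; _∷_; _++_; filter; length)
open import Data.List.Properties using (filter-all; filter-none)
open import Data.List.Relation.Unary.All as All using (All; all?)
open import Data.List.Relation.Unary.AllPairs using (_∷_)
open import Data.List.Relation.Unary.Any as Any using (here; there)
open import Data.List.Relation.Unary.Unique.Propositional using (Unique)
open import Data.List.Relation.Binary.Subset.Propositional using (_⊆_)
open import Data.List.Relation.Binary.Permutation.Propositional using (↭-sym)
open import Data.List.Relation.Binary.Permutation.Propositional.Properties using (∈-resp-↭)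
open import Data.List.Membership.Propositional using (_∈_; _∉_)
open import Data.List.Membership.Propositional.Properties using (∈-++⁻; ∈-++⁺ˡ; ∈-++⁺ʳ; ∈-map⁺; ∈-concatMap⁺)
open import Data.Empty using (⊥; ⊥-elim)
open import Function.Base using (_∘_)
open import Relation.Nullary.Decidable using (Dec; yes; no; from-yes)
open import Relation.Binary.PropositionalEquality

_≟_ : (x y : Cell) → Dec (x ≡ y)
_≟_ = ≡-dec ℤ._≟_ ℤ._≟_

open import Data.List.Membership.DecPropositional _≟_ using (_∈?_; _∉?_)

neg : Cell → Cell
neg (x , y) = (ℤ.- x , ℤ.- y)

-- norm six w = hexSum w / 2; estimates for the six-move norm are made on hexSum.
hexSum : Cell → ℕ
hexSum (x , y) = ∣ x ∣ + ∣ y ∣ + ∣ x ℤ.- y ∣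

hexSum-⊕ : ∀ u w → hexSum (u ⊕ w) ≤ hexSum u + hexSum w
hexSum-⊕ (a , b) (c , d) = begin
    ∣ a ℤ.+ c ∣ + ∣ b ℤ.+ d ∣ + ∣ (a ℤ.+ c) ℤ.- (b ℤ.+ d) ∣
  ≡⟨ cong (λ z → ∣ a ℤ.+ c ∣ + ∣ b ℤ.+ d ∣ + ∣ z ∣) (regroup a b c d) ⟩
    ∣ a ℤ.+ c ∣ + ∣ b ℤ.+ d ∣ + ∣ (a ℤ.- b) ℤ.+ (c ℤ.- d) ∣
  ≤⟨ ℕ.+-mono-≤ (ℕ.+-mono-≤ (ℤ.∣i+j∣≤∣i∣+∣j∣ a c) (ℤ.∣i+j∣≤∣i∣+∣j∣ b d)) (ℤ.∣i+j∣≤∣i∣+∣j∣ (a ℤ.- b) (c ℤ.- d)) ⟩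
    (∣ a ∣ + ∣ c ∣) + (∣ b ∣ + ∣ d ∣) + (∣ a ℤ.- b ∣ + ∣ c ℤ.- d ∣)
  ≡⟨ transpose (∣ a ∣) (∣ b ∣) (∣ a ℤ.- b ∣) (∣ c ∣) (∣ d ∣) (∣ c ℤ.- d ∣) ⟩
    ∣ a ∣ + ∣ b ∣ + ∣ a ℤ.- b ∣ + (∣ c ∣ + ∣ d ∣ + ∣ c ℤ.- d ∣)
  ∎
  where
  open ℕ.≤-Reasoning
  regroup : ∀ a b c d → (a ℤ.+ c) ℤ.- (b ℤ.+ d) ≡ (a ℤ.- b) ℤ.+ (c ℤ.- d)
  regroup = solve-∀
  transpose : ∀ a b c d e f → (a + d) + (b + e) + (c + f) ≡ a + b + c + (d + e + f)
  transpose = ℕ-Solver.solve-∀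

m+n≤1+m : ∀ m {n} → n ≤ 1 → m + n ≤ suc m
m+n≤1+m m n≤1 = ℕ.≤-trans (ℕ.+-monoʳ-≤ m n≤1) (ℕ.≤-reflexive (ℕ.+-comm m 1))

Unit : Rules → Cell → Set
Unit four  w = norm four w ≤ 1
Unit six   w = hexSum w ≤ 2
Unit eight w = norm eight w ≤ 1

unit? : ∀ r w → Dec (Unit r w)
unit? four  w = norm four w ≤? 1
unit? six   w = hexSum w ≤? 2
unit? eight w = norm eight w ≤? 1

neg-dirs-unit : ∀ r → All (Unit r ∘ neg) (dirs r)
neg-dirs-unit four  = from-yes (all? (unit? four ∘ neg) (dirs four))
neg-dirs-unit six   = from-yes (all? (unit? six ∘ neg) (dirs six))
neg-dirs-unit eight = from-yes (all? (unit? eight ∘ neg) (dirs eight))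

unit⇒norm≤1 : ∀ r {w} → Unit r w → norm r w ≤ 1
unit⇒norm≤1 four  h = h
unit⇒norm≤1 six   h = /-monoˡ-≤ 2 h
unit⇒norm≤1 eight h = h

norm-⊕-unit : ∀ r u {w} → Unit r w → norm r (u ⊕ w) ≤ suc (norm r u)
norm-⊕-unit four (a , b) {c , d} h = begin
    ∣ a ℤ.+ c ∣ + ∣ b ℤ.+ d ∣
  ≤⟨ ℕ.+-mono-≤ (ℤ.∣i+j∣≤∣i∣+∣j∣ a c) (ℤ.∣i+j∣≤∣i∣+∣j∣ b d) ⟩
    (∣ a ∣ + ∣ c ∣) + (∣ b ∣ + ∣ d ∣)
  ≡⟨ interchange ℕ.+-commutativeSemigroup (∣ a ∣) (∣ c ∣) (∣ b ∣) (∣ d ∣) ⟩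
    (∣ a ∣ + ∣ b ∣) + (∣ c ∣ + ∣ d ∣)
  ≤⟨ m+n≤1+m _ h ⟩
    suc (∣ a ∣ + ∣ b ∣)
  ∎
  where open ℕ.≤-Reasoning
norm-⊕-unit six u {w} h = begin
    hexSum (u ⊕ w) / 2
  ≤⟨ /-monoˡ-≤ 2 (ℕ.≤-trans (hexSum-⊕ u w) (ℕ.+-monoʳ-≤ (hexSum u) h)) ⟩
    (hexSum u + 2) / 2
  ≡⟨ cong (_/ 2) (ℕ.+-comm (hexSum u) 2) ⟩
    (2 + hexSum u) / 2
  ≡⟨ m/n≡1+[m∸n]/n (ℕ.m≤m+n 2 (hexSum u)) ⟩
    suc (hexSum u / 2)
  ∎
  where open ℕ.≤-Reasoning
norm-⊕-unit eight (a , b) {c , d} h = ℕ.⊔-lub (coord a c (ℕ.m≤m⊔n _ _) (ℕ.≤-trans (ℕ.m≤m⊔n _ _) h))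
                                              (coord b d (ℕ.m≤n⊔m _ _) (ℕ.≤-trans (ℕ.m≤n⊔m _ _) h))
  where
  coord : ∀ x z {m} → ∣ x ∣ ≤ m → ∣ z ∣ ≤ 1 → ∣ x ℤ.+ z ∣ ≤ suc m
  coord x z x≤m z≤1 = ℕ.≤-trans (ℤ.∣i+j∣≤∣i∣+∣j∣ x z) (ℕ.≤-trans (ℕ.+-monoˡ-≤ _ x≤m) (m+n≤1+m _ z≤1))

norm-neg : ∀ r u → norm r (neg u) ≡ norm r u
norm-neg four  (a , b) = cong₂ _+_ (ℤ.∣-i∣≡∣i∣ a) (ℤ.∣-i∣≡∣i∣ b)
norm-neg six   (a , b) = cong (_/ 2) (cong₂ _+_ (cong₂ _+_ (ℤ.∣-i∣≡∣i∣ a) (ℤ.∣-i∣≡∣i∣ b))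
  (trans (cong ∣_∣ (neg-diff a b)) (ℤ.∣-i∣≡∣i∣ (a ℤ.- b))))
  where
  neg-diff : ∀ a b → ℤ.- a ℤ.- ℤ.- b ≡ ℤ.- (a ℤ.- b)
  neg-diff = solve-∀
norm-neg eight (a , b) = cong₂ _⊔_ (ℤ.∣-i∣≡∣i∣ a) (ℤ.∣-i∣≡∣i∣ b)

⊖-self : ∀ x → x ⊖ x ≡ (ℤ.0ℤ , ℤ.0ℤ)
⊖-self (a , b) = cong₂ _,_ (ℤ.+-inverseʳ a) (ℤ.+-inverseʳ b)

⊖-swap : ∀ x y → x ⊖ y ≡ neg (y ⊖ x)
⊖-swap (a , b) (c , d) = cong₂ _,_ (swap a c) (swap b d)
  where
  swap : ∀ a c → a ℤ.- c ≡ ℤ.- (c ℤ.- a)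
  swap = solve-∀

⊖-⊕ : ∀ p v → p ⊖ (p ⊕ v) ≡ neg v
⊖-⊕ (a , b) (c , d) = cong₂ _,_ (cancel a c) (cancel b d)
  where
  cancel : ∀ p v → p ℤ.- (p ℤ.+ v) ≡ ℤ.- v
  cancel = solve-∀

⊖-detour : ∀ p v y → p ⊖ y ≡ ((p ⊕ v) ⊖ y) ⊕ neg v
⊖-detour (a , b) (c , d) (e , f) = cong₂ _,_ (detour a c e) (detour b d f)
  where
  detour : ∀ p v y → p ℤ.- y ≡ ((p ℤ.+ v) ℤ.- y) ℤ.+ ℤ.- v
  detour = solve-∀

dist-self : ∀ r x → dist r x x ≡ 0
dist-self r x = trans (cong (norm r) (⊖-self x)) (norm-origin r)
  where
  norm-origin : ∀ r → norm r (ℤ.0ℤ , ℤ.0ℤ) ≡ 0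
  norm-origin four  = refl
  norm-origin six   = refl
  norm-origin eight = refl

dist-sym : ∀ r x y → dist r x y ≡ dist r y x
dist-sym r x y = trans (cong (norm r) (⊖-swap x y)) (norm-neg r (y ⊖ x))

dist-adjacent : ∀ r {v} → v ∈ dirs r → ∀ p → dist r p (p ⊕ v) ≤ 1
dist-adjacent r {v} v∈D p =
  subst (λ w → norm r w ≤ 1) (sym (⊖-⊕ p v)) (unit⇒norm≤1 r (All.lookup (neg-dirs-unit r) v∈D))

dist-step : ∀ r {v} → v ∈ dirs r → ∀ p y → dist r p y ≤ suc (dist r (p ⊕ v) y)
dist-step r {v} v∈D p y =
  subst (λ w → norm r w ≤ suc (dist r (p ⊕ v) y)) (sym (⊖-detour p v y))
        (norm-⊕-unit r ((p ⊕ v) ⊖ y) (All.lookup (neg-dirs-unit r) v∈D))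

missing : List Cell → List Cell → ℕ
missing X Ys = length (filter (_∉? X) Ys)

missing-disjoint : ∀ {X Ys} → All (_∉ X) Ys → missing X Ys ≡ length Ys
missing-disjoint {X} h = cong length (filter-all (_∉? X) h)

missing-covered : ∀ {X Ys} → All (_∈ X) Ys → missing X Ys ≡ 0
missing-covered {X} h = cong length (filter-none (_∉? X) (All.map (λ y∈X y∉X → y∉X y∈X) h))

missing-∷-≤ : ∀ X y Ys → missing X (y ∷ Ys) ≤ suc (missing X Ys)
missing-∷-≤ X y Ys with y ∈? X
... | yes _ = ℕ.n≤1+n _
... | no  _ = ℕ.≤-refl

missing-≤-∷ : ∀ X y Ys → missing X Ys ≤ missing X (y ∷ Ys)
missing-≤-∷ X y Ys with y ∈? X
... | yes _ = ℕ.≤-refl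
... | no  _ = ℕ.n≤1+n _

missing-∷-mono : ∀ {X X' y Ys} k → (y ∈ X' → y ∈ X) → missing X Ys ≤ k + missing X' Ys →
            missing X (y ∷ Ys) ≤ k + missing X' (y ∷ Ys)
missing-∷-mono {X} {X'} {y} {Ys} k sub h with y ∈? X | y ∈? X'
... | yes _   | yes _    = h
... | yes _   | no  _    = ℕ.≤-trans h (ℕ.+-monoʳ-≤ k (ℕ.n≤1+n _))
... | no  y∉X | yes y∈X' = ⊥-elim (y∉X (sub y∈X'))
... | no  _   | no  _    = ℕ.≤-trans (s≤s h) (ℕ.≤-reflexive (sym (ℕ.+-suc k _)))

missing-antitone : ∀ {X X'} Ys → (∀ {y} → y ∈ Ys → y ∈ X' → y ∈ X) → missing X Ys ≤ missing X' Ys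
missing-antitone []       sub = z≤n
missing-antitone (y ∷ Ys) sub = missing-∷-mono 0 (sub (here refl)) (missing-antitone Ys (sub ∘ there))

⊆-∷⁻ : ∀ {X X' : List Cell} {q z} → X' ⊆ q ∷ X → z ≢ q → z ∈ X' → z ∈ X
⊆-∷⁻ X'⊆ z≢q z∈X' with X'⊆ z∈X'
... | here z≡q  = ⊥-elim (z≢q z≡q)
... | there z∈X = z∈X

missing-⊆-∷ : ∀ {X X' q} Ys → Unique Ys → X' ⊆ q ∷ X → missing X Ys ≤ suc (missing X' Ys)
missing-⊆-∷ [] _ _ = z≤n
missing-⊆-∷ {X} {X'} {q} (y ∷ Ys) (y∉Ys ∷ uniq) X'⊆ with y ≟ q
... | yes refl = begin
      missing X (y ∷ Ys)   ≤⟨ missing-∷-≤ X y Ys ⟩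
      suc (missing X Ys)   ≤⟨ s≤s (missing-antitone Ys λ z∈Ys → ⊆-∷⁻ X'⊆ (All.lookup y∉Ys z∈Ys ∘ sym)) ⟩
      suc (missing X' Ys)  ≤⟨ s≤s (missing-≤-∷ X' y Ys) ⟩
      suc (missing X' (y ∷ Ys)) ∎
  where open ℕ.≤-Reasoning
... | no y≢q = missing-∷-mono {X} {X'} 1 (⊆-∷⁻ X'⊆ y≢q) (missing-⊆-∷ Ys uniq X'⊆)

race : ℕ → ℕ → ℕ
race u v = (2 * u ∸ 1) ⊓ (2 * v)

race-step : ∀ {u u'} v → u ≤ suc u' → race u v ≤ suc (race v u')
race-step {u} {u'} v u≤1+u' = begin
    (2 * u ∸ 1) ⊓ (2 * v)
  ≤⟨ ℕ.⊓-mono-≤ (ℕ.∸-monoˡ-≤ 1 (ℕ.*-monoʳ-≤ 2 u≤1+u')) (ℕ.m≤n+m∸n (2 * v) 1) ⟩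
    (2 * suc u' ∸ 1) ⊓ suc (2 * v ∸ 1)
  ≡⟨ cong (λ m → (m ∸ 1) ⊓ suc (2 * v ∸ 1)) (ℕ.*-suc 2 u') ⟩
    suc (2 * u') ⊓ suc (2 * v ∸ 1)
  ≡⟨ cong suc (ℕ.⊓-comm (2 * u') (2 * v ∸ 1)) ⟩
    suc (race v u')
  ∎
  where open ℕ.≤-Reasoning

race-diag : ∀ s → race s s ≡ 2 * s ∸ 1
race-diag s = ℕ.m≤n⇒m⊓n≡m (ℕ.m∸n≤m (2 * s) 1)

module Separation (r : Rules) (board : List Cell) where

  record FarFrom (Y : List Cell) (k : ℕ) (x : Cell) : Set where
    constructor far
    field apart : ∀ {y} → y ∈ Y → k ≤ dist r x y
  open FarFrom public

  Separated : ℕ → List Cell → List Cell → Set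
  Separated k X Y = ∀ {x} → x ∈ X → FarFrom Y k x

  far-weaken : ∀ {Y k x} → FarFrom Y (suc k) x → FarFrom Y k x
  far-weaken x-far = far λ y∈Y → ℕ.≤-trans (ℕ.n≤1+n _) (apart x-far y∈Y)

  separated-sym : ∀ {k X Y} → Separated k X Y → Separated k Y X
  separated-sym {k} sep {y} y∈Y = far λ {x} x∈X → subst (k ≤_) (dist-sym r x y) (apart (sep x∈X) y∈Y)

  -- A man far from Y cannot jump over a man of Y, and landing just beyond a
  -- man that is far from Y keeps the jumper almost as far.
  jump-far : ∀ {Y k others l t} → (∀ {c} → c ∈ others → c ∈ Y ⊎ FarFrom Y (3 + k) c) →
             FarFrom Y (2 + k) l → Jump r board others l t → FarFrom Y (2 + k) t
  jump-far {Y} {k} {l = l} occupied l-far (v , v∈D , over , refl , _) with occupied over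
  ... | inj₁ over∈Y   = ⊥-elim (ℕ.<⇒≱ (apart l-far over∈Y) (ℕ.≤-trans (dist-adjacent r v∈D l) (s≤s z≤n)))
  ... | inj₂ over-far = far λ {y} y∈Y → ℕ.≤-pred (ℕ.≤-trans (apart over-far y∈Y) (dist-step r v∈D (l ⊕ v) y))

  chain-far : ∀ {Y k others l t} → (∀ {c} → c ∈ others → c ∈ Y ⊎ FarFrom Y (3 + k) c) →
              FarFrom Y (2 + k) l → JumpChain r board others l t → FarFrom Y (2 + k) t
  chain-far occupied l-far (one j)    = jump-far occupied l-far j
  chain-far occupied l-far (more j c) = chain-far occupied (jump-far occupied l-far j) c

  reach-far : ∀ {Y k others p q} → (∀ {c} → c ∈ others → c ∈ Y ⊎ FarFrom Y (3 + k) c) →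
              FarFrom Y (3 + k) p → Reach r board others p q → FarFrom Y (2 + k) q
  reach-far {p = p} occupied p-far (inj₁ (v , v∈D , refl , _)) =
    far λ {y} y∈Y → ℕ.≤-pred (ℕ.≤-trans (apart p-far y∈Y) (dist-step r v∈D p y))
  reach-far occupied p-far (inj₂ chain) = chain-far occupied (far-weaken p-far) chain

  army-move-separated : ∀ {k A Y opp own own'} → Separated (3 + k) (A ++ own) Y → opp ⊆ Y →
                        ArmyMove r board opp own own' → Separated (2 + k) (A ++ own') Y
  army-move-separated {k} {A} {Y} {opp} {own} sep opp⊆Y (p , q , rest , own↭ , own'↭ , reach) x∈
    with ∈-++⁻ A x∈
  ... | inj₁ x∈A    = far-weaken (sep (∈-++⁺ˡ x∈A))
  ... | inj₂ x∈own' = moved (∈-resp-↭ own'↭ x∈own')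
    where
    stayed : p ∷ rest ⊆ A ++ own
    stayed c∈ = ∈-++⁺ʳ A (∈-resp-↭ (↭-sym own↭) c∈)

    occupied : ∀ {c} → c ∈ rest ++ opp → c ∈ Y ⊎ FarFrom Y (3 + k) c
    occupied c∈ with ∈-++⁻ rest c∈
    ... | inj₁ c∈rest = inj₂ (sep (stayed (there c∈rest)))
    ... | inj₂ c∈opp  = inj₁ (opp⊆Y c∈opp)

    moved : ∀ {x} → x ∈ q ∷ rest → FarFrom Y (2 + k) x
    moved (here refl)    = reach-far occupied (sep (stayed (here refl))) reach
    moved (there x∈rest) = far-weaken (sep (stayed (there x∈rest)))

army-move-⊆ : ∀ {r board opp own own'} → ArmyMove r board opp own own' → ∃[ q ] own' ⊆ q ∷ own
army-move-⊆ (p , q , rest , own↭ , own'↭ , _) = q , λ x∈own' → moved (∈-resp-↭ own'↭ x∈own')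
  where
  moved : ∀ {x} → x ∈ q ∷ rest → x ∈ q ∷ _
  moved (here x≡q)     = here x≡q
  moved (there x∈rest) = there (∈-resp-↭ (↭-sym own↭) (there x∈rest))

module Analysis (r : Rules) (board : List Cell) {B R : List Cell} (uB : Unique B) (uR : Unique R) where
  open Separation r board

  Apart : ℕ → Position → Set
  Apart k (b , rd) = Separated k (B ++ b) (R ++ rd)

  move-apart : ∀ {pl st st' k} → Move r board pl st st' → Apart (3 + k) st → Apart (2 + k) st'
  move-apart {blue} {b , rd} {b' , .rd} (m , refl) ap = army-move-separated ap (∈-++⁺ʳ R) m
  move-apart {red}  {b , rd} {.b , rd'} (m , refl) ap =
    separated-sym (army-move-separated (separated-sym ap) (∈-++⁺ʳ B) m)

  apart-disjoint : ∀ {k b rd} → Apart (suc k) (b , rd) → All (_∉ b) R × All (_∉ rd) B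
  apart-disjoint {k} ap =
      All.tabulate (λ {y} y∈R y∈b → clash {y} (apart (ap (∈-++⁺ʳ B y∈b)) (∈-++⁺ˡ y∈R)))
    , All.tabulate (λ {x} x∈B x∈rd → clash {x} (apart (ap (∈-++⁺ˡ x∈B)) (∈-++⁺ʳ R x∈rd)))
    where
    clash : ∀ {x} → suc k ≤ dist r x x → ⊥
    clash {x} h with subst (suc k ≤_) (dist-self r x) h
    ... | ()

  raceBound : Player → Position → ℕ
  raceBound blue (b , rd) = race (missing b R) (missing rd B)
  raceBound red  (b , rd) = race (missing rd B) (missing b R)

  move-race : ∀ {pl st st'} → Move r board pl st st' → raceBound pl st ≤ suc (raceBound (other pl) st')
  move-race {blue} {b , rd} {b' , .rd} (m , refl) =
    race-step (missing rd B) (missing-⊆-∷ R uR (proj₂ (army-move-⊆ m)))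
  move-race {red}  {b , rd} {.b , rd'} (m , refl) =
    race-step (missing b R) (missing-⊆-∷ B uB (proj₂ (army-move-⊆ m)))

  won-race : ∀ {pl st} → Won B R st → raceBound pl st ≡ 0
  won-race {blue} {b , rd} (inj₁ w) rewrite missing-covered w = refl
  won-race {blue} {b , rd} (inj₂ w) rewrite missing-covered w = ℕ.⊓-zeroʳ _
  won-race {red}  {b , rd} (inj₁ w) rewrite missing-covered w = ℕ.⊓-zeroʳ _
  won-race {red}  {b , rd} (inj₂ w) rewrite missing-covered w = refl

  endgame : ∀ {pl st n} → Game r board B R pl st n → raceBound pl st ≤ n
  endgame {pl} (stop w) = ℕ.≤-reflexive (won-race {pl} w)
  endgame (step _ m g)  = ℕ.≤-trans (move-race m) (s≤s (endgame g))

  module _ {s} (lenB : length B ≡ s) (lenR : length R ≡ s) where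

    start-race : ∀ {pl b rd} → All (_∉ b) R × All (_∉ rd) B → raceBound pl (b , rd) ≡ 2 * s ∸ 1
    start-race {blue} (b∉ , rd∉)
      rewrite missing-disjoint b∉ | missing-disjoint rd∉ | lenB | lenR = race-diag s
    start-race {red}  (b∉ , rd∉)
      rewrite missing-disjoint b∉ | missing-disjoint rd∉ | lenB | lenR = race-diag s

    approach : 1 ≤ s → ∀ k {pl st n} → Apart (2 + k) st → Game r board B R pl st n → k + (2 * s ∸ 1) ≤ n
    approach _ zero {pl} {b , rd} ap g = subst (_≤ _) (start-race {pl} (apart-disjoint ap)) (endgame g)
    approach 1≤s (suc k) {pl} {b , rd} ap (stop w) =
      ⊥-elim (ℕ.<⇒≢ (ℕ.∸-monoˡ-≤ 1 (ℕ.*-monoʳ-≤ 2 1≤s))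
                    (trans (sym (won-race {pl} w)) (start-race {pl} (apart-disjoint ap))))
    approach 1≤s (suc k) ap (step _ m g) = s≤s (approach 1≤s k (move-apart m ap) g)

minList-≤ : ∀ {xs z} → z ∈ xs → minList xs ≤ z
minList-≤ {x ∷ []}     (here refl) = ℕ.≤-refl
minList-≤ {x ∷ y ∷ ys} (here refl) = ℕ.m⊓n≤m x _
minList-≤ {x ∷ y ∷ ys} (there z∈) = ℕ.≤-trans (ℕ.m⊓n≤n x _) (minList-≤ z∈)

setDist-≤ : ∀ r {B R x y} → x ∈ B → y ∈ R → setDist r B R ≤ dist r x y
setDist-≤ r x∈B y∈R = minList-≤ (∈-concatMap⁺ _ (Any.map (λ { refl → ∈-map⁺ _ y∈R }) x∈B))

theorem1 : (r : Rules) (board B R : List Cell) (s : ℕ) →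
    All (_∈ board) B → All (_∈ board) R →
    Unique B → Unique R → All (_∉ R) B →
    length B ≡ s → length R ≡ s → 1 ≤ s →
    (first : Player) (n : ℕ) → Game r board B R first (B , R) n →
    bound r B R s ≤ n
theorem1 r board B R s _ _ uB uR B∉R lenB lenR 1≤s first n game = by-distance (2 ≤? d)
  where
  open Separation r board
  open Analysis r board uB uR

  d : ℕ
  d = setDist r B R

  initial : Apart d (B , R)
  initial x∈ = far λ y∈ → setDist-≤ r (reduce (∈-++⁻ B x∈)) (reduce (∈-++⁻ R y∈))

  R∉B : All (_∉ B) R
  R∉B = All.tabulate λ y∈R y∈B → All.lookup B∉R y∈B y∈R

  by-distance : Dec (2 ≤ d) → (d ∸ 2) + (2 * s ∸ 1) ≤ n
  by-distance (yes 2≤d) =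
    approach lenB lenR 1≤s (d ∸ 2) (subst (λ k → Apart k (B , R)) (sym (ℕ.m+[n∸m]≡n 2≤d)) initial)
             game
  by-distance (no 2≰d) =
    subst₂ (λ k m → k + m ≤ n) (sym (ℕ.m≤n⇒m∸n≡0 (ℕ.<⇒≤ (ℕ.≰⇒> 2≰d))))
           (start-race lenB lenR {first} (R∉B , B∉R)) (endgame game)
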